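{- There exists a simple directed temporal graph $\mathcal{G}=(V,E,\lambda)$, considered with non-strict temporal paths, such that there is no simple directed temporal graph $\mathcal{H}$ on $V$, considered with strict temporal paths, that is support equivalent to $\mathcal{G}$. In other words, some graph in the setting D \& non-strict \& simple has no support equivalent graph in the setting D \& strict \& simple.
   Context: A directed temporal graph is a triple $\mathcal{G}=(V,E,\lambda)$ with $V$ a finite vertex set, $E\subseteq\{(u,v)\in V\times V: u\ne v\}$ a set of arcs, and $\lambda\colon E\to 2^{\mathbb{N}}\setminus\{\emptyset\}$ assigning to each arc a nonempty finite set of time labels. $\mathcal{G}$ is simple if $|\lambda(e)|=1$ for all $e$. A temporal path from $u$ to $v$ is a sequence $(e_1,t_1),\dots,(e_k,t_k)$, $k\ge1$, with $t_i\in\lambda(e_i)$, such that $e_1,\dots,e_k$ form a directed path from $u$ to $v$ in $(V,E)$ (distinct vertices) and $t_1\le\dots\le t_k$; it is strict if $t_1<\dots<t_k$. In the non-strict setting the temporal paths of a graph are all temporal paths; in the strict setting only strict temporal paths. Two temporal paths share the same support if they visit the same vertices in the same order. Two temporal graphs on the same vertex set are support equivalent if for every temporal path (in its setting) in either graph there is a temporal path (in its setting) in the other graph with the same support. -}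

module Defs where

open import Data.Nat using (ℕ; _≤_; _<_)
open import Data.Fin using (Fin)
open import Data.Maybe using (Maybe; just; nothing)
open import Data.List using (List; []; _∷_)
open import Data.List.Relation.Unary.Unique.Propositional using (Unique)
open import Data.List.Relation.Unary.Linked using (Linked)
open import Data.Product using (Σ; _×_)
open import Relation.Binary.PropositionalEquality using (_≡_)

-- A simple directed temporal graph on vertex set V = Fin n:
-- label u v ≡ just t  means (u,v) ∈ E with λ(u,v) = {t};
-- label u v ≡ nothing means (u,v) ∉ E.  No loops.
record SimpleTG (n : ℕ) : Set where
  field
    label   : Fin n → Fin n → Maybe ℕ
    noLoops : ∀ u → label u u ≡ nothing
open SimpleTG public

data Steps {n : ℕ} (G : SimpleTG n) : List (Fin n) → List ℕ → Set where
  one  : ∀ {u v t} → label G u v ≡ just t → Steps G (u ∷ v ∷ []) (t ∷ [])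
  more : ∀ {u v vs t ts} → label G u v ≡ just t → Steps G (v ∷ vs) ts →
         Steps G (u ∷ v ∷ vs) (t ∷ ts)

TemporalPathWithSupport : {n : ℕ} → SimpleTG n → (ℕ → ℕ → Set) → List (Fin n) → Set
TemporalPathWithSupport G R vs =
  Unique vs × Σ (List ℕ) (λ ts → Steps G vs ts × Linked R ts)

NonStrictPath StrictPath : {n : ℕ} → SimpleTG n → List (Fin n) → Set
NonStrictPath G = TemporalPathWithSupport G _≤_
StrictPath    G = TemporalPathWithSupport G _<_

SupportEquivNSvsS : {n : ℕ} → SimpleTG n → SimpleTG n → Set
SupportEquivNSvsS G H =
  ∀ vs → (NonStrictPath G vs → StrictPath H vs) × (StrictPath H vs → NonStrictPath G vs)

-- The directed triangle a → b → c → a with every arc labelled 1 has all three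
-- two-arc paths a b c, b c a and c a b as non-strict temporal paths. A strict
-- graph H with the same supports must contain each of them as a strict path,
-- so its labels satisfy λ(ab) < λ(bc) < λ(ca) < λ(ab), which is impossible.
module Submission where

open import Defs
open import Data.Nat using (ℕ; _<_)
open import Data.Nat.Properties using (<-trans; <-irrefl; ≤-refl)
open import Data.Product using (Σ; _,_; proj₁)
open import Data.Fin using (Fin; zero; suc)
open import Data.Maybe using (Maybe; just; nothing)
open import Data.Maybe.Properties using (just-injective)
open import Data.List using ([]; _∷_)
open import Data.List.Relation.Unary.Linked using ([-]; _∷_)
open import Data.List.Relation.Unary.AllPairs using ([]; _∷_)
open import Data.List.Relation.Unary.All using ([]; _∷_)
open import Data.Empty using (⊥)
open import Relation.Nullary using (¬_)
open import Relation.Binary.PropositionalEquality using (_≡_; refl; trans; sym)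

pattern a = zero
pattern b = suc zero
pattern c = suc (suc zero)

triangleLabel : Fin 3 → Fin 3 → Maybe ℕ
triangleLabel a b = just 1
triangleLabel b c = just 1
triangleLabel c a = just 1
triangleLabel _ _ = nothing

triangle : SimpleTG 3
triangle = record { label = triangleLabel ; noLoops = λ { a → refl ; b → refl ; c → refl } }

triangle-nonStrict-abc : NonStrictPath triangle (a ∷ b ∷ c ∷ [])
triangle-nonStrict-abc =
  ((λ ()) ∷ (λ ()) ∷ []) ∷ ((λ ()) ∷ []) ∷ [] ∷ [] , _ , more refl (one refl) , ≤-refl ∷ [-]

triangle-nonStrict-bca : NonStrictPath triangle (b ∷ c ∷ a ∷ [])
triangle-nonStrict-bca =
  ((λ ()) ∷ (λ ()) ∷ []) ∷ ((λ ()) ∷ []) ∷ [] ∷ [] , _ , more refl (one refl) , ≤-refl ∷ [-]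

triangle-nonStrict-cab : NonStrictPath triangle (c ∷ a ∷ b ∷ [])
triangle-nonStrict-cab =
  ((λ ()) ∷ (λ ()) ∷ []) ∷ ((λ ()) ∷ []) ∷ [] ∷ [] , _ , more refl (one refl) , ≤-refl ∷ [-]

record IncreasingLabels {n : ℕ} (H : SimpleTG n) (x y z : Fin n) : Set where
  constructor increasing
  field
    {first second} : ℕ
    label-xy       : label H x y ≡ just first
    label-yz       : label H y z ≡ just second
    first<second   : first < second

strictPath⇒increasingLabels : ∀ {n} (H : SimpleTG n) {x y z : Fin n} →
                              StrictPath H (x ∷ y ∷ z ∷ []) → IncreasingLabels H x y z
strictPath⇒increasingLabels H (_ , _ , more p (one q) , s<t ∷ [-]) = increasing p q s<t

just-unique : ∀ {m : Maybe ℕ} {s t : ℕ} → m ≡ just s → m ≡ just t → s ≡ t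
just-unique p q = just-injective (trans (sym p) q)

no-increasing-cycle : ∀ {n} {H : SimpleTG n} {x y z : Fin n} →
                      IncreasingLabels H x y z → IncreasingLabels H y z x →
                      IncreasingLabels H z x y → ⊥
no-increasing-cycle (increasing xy yz xy<yz) (increasing yz′ zx yz<zx) (increasing zx′ xy′ zx<xy)
  with refl ← just-unique yz yz′ | refl ← just-unique zx zx′ | refl ← just-unique xy xy′
  = <-irrefl refl (<-trans xy<yz (<-trans yz<zx zx<xy))

lemma11 : Σ ℕ (λ n → Σ (SimpleTG n) (λ G → ¬ Σ (SimpleTG n) (λ H → SupportEquivNSvsS G H)))
lemma11 = 3 , triangle , λ (H , equiv) →
  let strict : ∀ {x y z} → NonStrictPath triangle (x ∷ y ∷ z ∷ []) → IncreasingLabels H x y z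
      strict p = strictPath⇒increasingLabels H (proj₁ (equiv _) p)
  in no-increasing-cycle (strict triangle-nonStrict-abc) (strict triangle-nonStrict-bca)
                         (strict triangle-nonStrict-cab)
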